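{- Let $N\geqslant 1$ and $1\leqslant h_1<h_2<\cdots<h_k$ be integers, and suppose that the set of positive integers $n$ with $t(n)=t(N)$ and $t(n+h_i)=t(N+h_i)$ for all $1\le i\le k$ is infinite. Let $n_1<n_2<\cdots$ be the increasing enumeration of all such $n$ with $n\geqslant N$ (so $n_1=N$). Then $$\limsup_{l\to+\infty}\,(n_{l+1}-n_l-h_k)=+\infty.$$
   Context: Every integer $n\ge 1$ is assigned a finite rooted planar tree $t(n)$: $t(1)$ is the single-vertex tree; if $n=p_1^{a_1}\cdots p_s^{a_s}$ with primes $p_1<\dots<p_s$ and $a_i\ge1$, then $t(n)$ consists of a root with $s$ edges to children, ordered left to right, the $i$-th edge leading to a copy of $t(a_i)$ rooted at that child. -}

module Defs where

open import Data.Nat using (ℕ; zero; suc; _+_; _≤_; _<_; _/_)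
open import Data.Bool using (true; false)
open import Data.Nat.Divisibility using (_∣?_)
open import Data.Nat.Primality using (prime?)
open import Data.List using (List; []; _∷_; map; filter; upTo)
open import Data.Fin using (Fin; zero; suc; fromℕ)
open import Data.Product using (Σ; _×_; ∃)
open import Relation.Nullary.Decidable using (does; _×-dec_)
open import Relation.Binary.PropositionalEquality using (_≡_)

data Tree : Set where
  node : List Tree → Tree

-- p-adic valuation of n (for p ≥ 2, n ≥ 1), computed by repeated division,
-- with a fuel argument; fuel n is always sufficient since p^a ≤ n.
valF : ℕ → ℕ → ℕ → ℕ
valF zero p n = 0
valF (suc f) zero n = 0
valF (suc f) (suc zero) n = 0
valF (suc f) (suc (suc q)) zero = 0
valF (suc f) (suc (suc q)) (suc m) with does (suc (suc q) ∣? suc m)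
... | false = 0
... | true  = suc (valF f (suc (suc q)) (suc m / suc (suc q)))

val : ℕ → ℕ → ℕ
val p n = valF n p n

primeDivisors : ℕ → List ℕ
primeDivisors n = filter (λ p → prime? p ×-dec p ∣? n) (upTo (suc n))

exponents : ℕ → List ℕ
exponents n = map (λ p → val p n) (primeDivisors n)

-- t with fuel; fuel n suffices for t(n) since every exponent a of n is < n
-- (for n ≥ 2) and t(1) is the single vertex.
tF : ℕ → ℕ → Tree
tF zero n = node []
tF (suc f) n = node (map (tF f) (exponents n))

-- t(n), for n ≥ 1 (value at 0 is irrelevant)
t : ℕ → Tree
t n = tF n n

SamePattern : (N : ℕ) {k : ℕ} (h : Fin k → ℕ) (n : ℕ) → Set
SamePattern N h n = (t n ≡ t N) × (∀ i → t (n + h i) ≡ t (N + h i))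

{-# OPTIONS --safe #-}
-- The root of t(m) has ω(m) children, ω(m) being the number of distinct prime factors of m.
-- By the Chinese remainder theorem there are arbitrarily long runs n, …, n + G − 1 of
-- consecutive integers, each divisible by more than ω(N) distinct primes, so no member of
-- the run has tree t(N). A run starting after n_L lies in a gap n_l < n ≤ n + G ≤ n_(l+1)
-- with l ≥ L. Only t(n_l) = t(N) is used; the shifts h_i enter only through the length of the run.
module Submission where

open import Data.Nat
open import Data.Nat.Properties
open import Data.Nat.Divisibility
open import Data.Nat.DivMod using (_%_; [m+kn]%n≡m%n; m<n⇒m%n≡m)
open import Data.Nat.Primality using (Prime; prime?; euclidsLemma; prime⇒irreducible; prime⇒nonZero; ¬prime[1])
open import Data.Nat.Primality.Factorisation using (factorise)
open import Data.Nat.Coprimality using (Coprime; coprime-Bézout)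
open import Data.Nat.GCD using (module Bézout)
open import Data.Nat.Solver using (module +-*-Solver)
open import Data.List using ([]; _∷_; [_]; _++_; length; filter; upTo)
open import Data.List.Properties using (filter-++; filter-accept; length-++; applyUpTo-∷ʳ; length-map)
open import Data.List.Relation.Unary.All using (_∷_)
open import Data.Fin using (Fin; zero; suc; fromℕ; inject₁)
open import Data.Product using (∃; ∃-syntax; _×_; _,_; proj₁; proj₂)
open import Data.Sum using (inj₁; inj₂)
open import Function using (_∘_)
open import Level using (0ℓ)
open import Relation.Nullary using (¬_; contradiction)
open import Relation.Nullary.Decidable using (_×-dec_)
open import Relation.Unary using (Pred; Decidable)
open import Relation.Binary.PropositionalEquality using (_≡_; refl; sym; trans; cong; subst; module ≡-Reasoning)
open import Defs

StrictlyIncreasing : (ℕ → ℕ) → Set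
StrictlyIncreasing f = ∀ i → f i < f (suc i)

strictlyIncreasing⇒mono-< : ∀ {f} → StrictlyIncreasing f → ∀ {i j} → i < j → f i < f j
strictlyIncreasing⇒mono-< {f} inc = go ∘ ≤⇒≤′
  where
  go : ∀ {i j} → suc i ≤′ j → f i < f j
  go ≤′-refl = inc _
  go (≤′-step i<j) = <-trans (go i<j) (inc _)

straddle : ∀ {e} → StrictlyIncreasing e → ∀ {a} w → e a < w →
           ∃[ l ] a ≤ l × e l < w × w ≤ e (suc l)
straddle inc zero ()
straddle {e} inc {a} (suc w) ea<1+w with m<1+n⇒m<n∨m≡n ea<1+w
... | inj₂ refl = a , ≤-refl , n<1+n (e a) , inc a
... | inj₁ ea<w with straddle inc w ea<w
...   | l , a≤l , el<w , w≤el′ with m≤n⇒m<n∨m≡n w≤el′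
...     | inj₁ w<el′ = l , a≤l , m<n⇒m<1+n el<w , w<el′
...     | inj₂ refl = suc l , m≤n⇒m≤1+n a≤l , n<1+n (e (suc l)) , inc (suc l)

m≤n⇒m∣n! : ∀ {m n} .{{_ : NonZero m}} → m ≤ n → m ∣ n !
m≤n⇒m∣n! {suc m} m≤n = ∣-trans (m∣m*n (m !)) (m≤n⇒m!∣n! m≤n)

primeAbove : ∀ n → ∃[ p ] Prime p × n < p
primeAbove n with factorise (suc (n !))
... | record { factors = [] ; isFactorisation = 1+n!≡1 } =
  contradiction (suc-injective 1+n!≡1) (>⇒≢ (1≤n! n))
... | record { factors = p ∷ ps ; isFactorisation = 1+n!≡p*ps ; factorsPrime = p-prime ∷ _ } =
  p , p-prime , ≰⇒> p≰n
  where
  p∣n!+1 : p ∣ n ! + 1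
  p∣n!+1 = subst (p ∣_) (trans (sym 1+n!≡p*ps) (+-comm 1 (n !))) (m∣m*n _)
  p≰n : ¬ p ≤ n
  p≰n p≤n = ¬prime[1] (subst Prime (∣1⇒≡1 p∣1) p-prime)
    where
    p∣1 : p ∣ 1
    p∣1 = ∣m+n∣m⇒∣n p∣n!+1 (m≤n⇒m∣n! {{prime⇒nonZero p-prime}} p≤n)

primes : ℕ → ℕ
primes zero = proj₁ (primeAbove 0)
primes (suc i) = proj₁ (primeAbove (primes i))

primes-prime : ∀ i → Prime (primes i)
primes-prime zero = proj₁ (proj₂ (primeAbove 0))
primes-prime (suc i) = proj₁ (proj₂ (primeAbove (primes i)))

primes-strictlyIncreasing : StrictlyIncreasing primes
primes-strictlyIncreasing i = proj₂ (proj₂ (primeAbove (primes i)))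

primes-mono-< : ∀ {i j} → i < j → primes i < primes j
primes-mono-< = strictlyIncreasing⇒mono-< primes-strictlyIncreasing

primorial : ℕ → ℕ
primorial zero = 1
primorial (suc T) = primorial T * primes T

primes∣primorial : ∀ {i T} → i < T → primes i ∣ primorial T
primes∣primorial {i} = go ∘ ≤⇒≤′
  where
  go : ∀ {T} → suc i ≤′ T → primes i ∣ primorial T
  go ≤′-refl = n∣m*n (primorial i)
  go (≤′-step i<T) = ∣m⇒∣m*n _ (go i<T)

primes∤primorial : ∀ {i T} → T ≤ i → ¬ primes i ∣ primorial T
primes∤primorial {i} {zero} _ pᵢ∣1 = ¬prime[1] (subst Prime (∣1⇒≡1 pᵢ∣1) (primes-prime i))
primes∤primorial {i} {suc T} T<i pᵢ∣ with euclidsLemma (primorial T) (primes T) (primes-prime i) pᵢ∣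
... | inj₁ pᵢ∣primorial = primes∤primorial (<⇒≤ T<i) pᵢ∣primorial
... | inj₂ pᵢ∣p_T = <⇒≱ (primes-mono-< T<i) (∣⇒≤ {{prime⇒nonZero (primes-prime T)}} pᵢ∣p_T)

prime∤⇒coprime : ∀ {p n} → Prime p → ¬ p ∣ n → Coprime n p
prime∤⇒coprime p-prime p∤n (d∣n , d∣p) with prime⇒irreducible p-prime d∣p
... | inj₁ d≡1 = d≡1
... | inj₂ refl = contradiction d∣n p∤n

primorial-coprime : ∀ T → Coprime (primorial T) (primes T)
primorial-coprime T = prime∤⇒coprime (primes-prime T) (primes∤primorial {T} ≤-refl)

coprime⇒linearSolvable : ∀ {q p} .{{_ : NonZero p}} → Coprime q p → ∀ r → ∃[ x ] p ∣ r + q * x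
coprime⇒linearSolvable {q} {suc p} q⊥p r with coprime-Bézout q⊥p
... | Bézout.+- x y 1+y[1+p]≡xq = x * (p * r) , divides (r + y * (p * r)) (begin
  r + q * (x * (p * r))           ≡⟨ cong (r +_) (*-assoc q x (p * r)) ⟨
  r + q * x * (p * r)             ≡⟨ cong (λ z → r + z * (p * r)) (*-comm q x) ⟩
  r + x * q * (p * r)             ≡⟨ cong (λ z → r + z * (p * r)) 1+y[1+p]≡xq ⟨
  r + (1 + y * suc p) * (p * r)   ≡⟨ solve 3 (λ r y p → r :+ (con 1 :+ y :* (con 1 :+ p)) :* (p :* r)
                                                     := (r :+ y :* (p :* r)) :* (con 1 :+ p)) refl r y p ⟩
  (r + y * (p * r)) * suc p       ∎)
  where open ≡-Reasoning; open +-*-Solver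
... | Bézout.-+ x y 1+xq≡y[1+p] = x * r , divides (r * y) (begin
  r + q * (x * r)                 ≡⟨ solve 3 (λ r q x → r :+ q :* (x :* r) := r :* (con 1 :+ x :* q)) refl r q x ⟩
  r * (1 + x * q)                 ≡⟨ cong (r *_) 1+xq≡y[1+p] ⟩
  r * (y * suc p)                 ≡⟨ *-assoc r y (suc p) ⟨
  r * y * suc p                   ∎)
  where open ≡-Reasoning; open +-*-Solver

chineseRemainder : (c : ℕ → ℕ) (X T : ℕ) → ∃[ n ] X ≤ n × (∀ {i} → i < T → primes i ∣ n + c i)
chineseRemainder c X zero = X , ≤-refl , λ ()
chineseRemainder c X (suc T) with chineseRemainder c X T
... | n , X≤n , solves
  with coprime⇒linearSolvable {{prime⇒nonZero (primes-prime T)}} (primorial-coprime T) (n + c T)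
... | x , p_T∣ = n + primorial T * x , ≤-trans X≤n (m≤m+n n _) , solves′
  where
  reorder : ∀ i → n + c i + primorial T * x ≡ n + primorial T * x + c i
  reorder i = solve 3 (λ n c qx → n :+ c :+ qx := n :+ qx :+ c) refl n (c i) (primorial T * x)
    where open +-*-Solver
  solves′ : ∀ {i} → i < suc T → primes i ∣ n + primorial T * x + c i
  solves′ {i} i<1+T with m<1+n⇒m<n∨m≡n i<1+T
  ... | inj₂ refl = subst (primes i ∣_) (reorder i) p_T∣
  ... | inj₁ i<T = subst (primes i ∣_) (reorder i) (∣m∣n⇒∣m+n (solves i<T) (∣m⇒∣m*n x (primes∣primorial i<T)))

module _ {P : Pred ℕ 0ℓ} (P? : Decidable P) where

  count : ℕ → ℕ
  count n = length (filter P? (upTo n))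

  count-suc : ∀ n → count (suc n) ≡ count n + length (filter P? [ n ])
  count-suc n = begin
    length (filter P? (upTo (suc n)))               ≡⟨ cong (length ∘ filter P?) (applyUpTo-∷ʳ (λ i → i) n) ⟨
    length (filter P? (upTo n ++ [ n ]))            ≡⟨ cong length (filter-++ P? (upTo n) [ n ]) ⟩
    length (filter P? (upTo n) ++ filter P? [ n ])  ≡⟨ length-++ (filter P? (upTo n)) ⟩
    count n + length (filter P? [ n ])              ∎
    where open ≡-Reasoning

  count-accept : ∀ {n} → P n → count (suc n) ≡ suc (count n)
  count-accept {n} Pn = begin
    count (suc n)                       ≡⟨ count-suc n ⟩
    count n + length (filter P? [ n ])  ≡⟨ cong (λ xs → count n + length xs) (filter-accept P? Pn) ⟩
    count n + 1                         ≡⟨ +-comm (count n) 1 ⟩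
    suc (count n)                       ∎
    where open ≡-Reasoning

  count-mono : ∀ {m n} → m ≤ n → count m ≤ count n
  count-mono = go ∘ ≤⇒≤′
    where
    go : ∀ {m n} → m ≤′ n → count m ≤ count n
    go ≤′-refl = ≤-refl
    go (≤′-step {n} m≤n) = ≤-trans (go m≤n) (subst (count n ≤_) (sym (count-suc n)) (m≤m+n _ _))

  count-< : ∀ {n K} → P n → n < K → count n < count K
  count-< {n} {K} Pn n<K = begin-strict
    count n        <⟨ n<1+n (count n) ⟩
    suc (count n)  ≡⟨ count-accept Pn ⟨
    count (suc n)  ≤⟨ count-mono n<K ⟩
    count K        ∎
    where open ≤-Reasoning

  count-lowerBound : ∀ {q K} → StrictlyIncreasing q → ∀ s → (∀ {r} → r ≤ s → P (q r)) → q s < K → s < count K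
  count-lowerBound inc zero P-q q₀<K = ≤-<-trans z≤n (count-< (P-q z≤n) q₀<K)
  count-lowerBound inc (suc s) P-q q<K =
    ≤-<-trans (count-lowerBound inc s (P-q ∘ m≤n⇒m≤1+n) (inc s)) (count-< (P-q ≤-refl) q<K)

ω : ℕ → ℕ
ω n = length (primeDivisors n)

ω-lowerBound : ∀ {m q} .{{_ : NonZero m}} → StrictlyIncreasing q → ∀ s →
               (∀ {r} → r ≤ s → Prime (q r) × q r ∣ m) → s < ω m
ω-lowerBound {m} inc s q-prime∣m =
  count-lowerBound (λ p → prime? p ×-dec p ∣? m) inc s q-prime∣m (s≤s (∣⇒≤ (proj₂ (q-prime∣m ≤-refl))))

consecutive-ω-large : ∀ s G .{{_ : NonZero G}} X → ∃[ n ] X < n × (∀ {m} → n ≤ m → m < n + G → s < ω m)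
consecutive-ω-large s G X with chineseRemainder (_% G) (suc X) (suc s * G)
... | n , X<n , solves = n , X<n , large
  where
  -- The residue i % G imposed at p_i makes p_(j + rG) divide n + j for every r ≤ s.
  large : ∀ {m} → n ≤ m → m < n + G → s < ω m
  large {m} n≤m m<n+G = ω-lowerBound {{>-nonZero (<-≤-trans (≤-<-trans z≤n X<n) n≤m)}} q-inc s q-prime∣m
    where
    j = m ∸ n
    j<G : j < G
    j<G = m<n+o⇒m∸n<o m n m<n+G
    q : ℕ → ℕ
    q r = primes (j + r * G)
    q-inc : StrictlyIncreasing q
    q-inc r = primes-mono-< (+-monoʳ-< j (m<n+m (r * G) (>-nonZero⁻¹ G)))
    q-prime∣m : ∀ {r} → r ≤ s → Prime (q r) × q r ∣ m
    q-prime∣m {r} r≤s = primes-prime (j + r * G) , subst (q r ∣_) n+[j+rG]%G≡m (solves j+rG<[1+s]G)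
      where
      j+rG<[1+s]G : j + r * G < suc s * G
      j+rG<[1+s]G = <-≤-trans (+-monoˡ-< (r * G) j<G) (*-monoˡ-≤ G (s≤s r≤s))
      n+[j+rG]%G≡m : n + (j + r * G) % G ≡ m
      n+[j+rG]%G≡m = trans (cong (n +_) (trans ([m+kn]%n≡m%n j r G) (m<n⇒m%n≡m j<G))) (m+[n∸m]≡n n≤m)

degree : Tree → ℕ
degree (node ts) = length ts

degree-t : ∀ n → degree (t n) ≡ ω n
degree-t zero = refl
degree-t (suc n) = trans (length-map (tF n) (exponents (suc n))) (length-map _ (primeDivisors (suc n)))

t≡⇒ω≡ : ∀ {m n} → t m ≡ t n → ω m ≡ ω n
t≡⇒ω≡ {m} {n} tm≡tn = begin
  ω m           ≡⟨ degree-t m ⟨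
  degree (t m)  ≡⟨ cong degree tm≡tn ⟩
  degree (t n)  ≡⟨ degree-t n ⟩
  ω n           ∎
  where open ≡-Reasoning

t-avoidsInterval : ∀ N G .{{_ : NonZero G}} X →
                   ∃[ n ] X < n × (∀ m → n ≤ m → t m ≡ t N → n + G ≤ m)
t-avoidsInterval N G X with consecutive-ω-large (ω N) G X
... | n , X<n , large = n , X<n , λ m n≤m tm≡tN →
  ≮⇒≥ λ m<n+G → <⇒≢ (large n≤m m<n+G) (sym (t≡⇒ω≡ tm≡tN))

theorem3 : (N : ℕ) → 1 ≤ N →
    (k : ℕ) → (h : Fin (suc k) → ℕ) → 1 ≤ h zero →
    (∀ (i : Fin k) → h (inject₁ i) < h (suc i)) →
    (∀ m → ∃ λ n → m ≤ n × 1 ≤ n × SamePattern N h n) →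
    (e : ℕ → ℕ) →
    (∀ l → e l < e (suc l)) →
    (∀ l → N ≤ e l × SamePattern N h (e l)) →
    (∀ n → N ≤ n → SamePattern N h n → ∃ λ l → e l ≡ n) →
    ∀ (M L : ℕ) → ∃ λ l → L ≤ l × e l + h (fromℕ k) + M ≤ e (suc l)
theorem3 N _ k h _ _ _ e e-inc e-pattern _ M L
  with t-avoidsInterval N (suc (h (fromℕ k) + M)) (e L)
... | n , eL<n , avoids with straddle e-inc n eL<n
... | l , L≤l , eₗ<n , n≤eₗ₊₁ = l , L≤l , (begin
  e l + H + M        ≡⟨ +-assoc (e l) H M ⟩
  e l + (H + M)      ≤⟨ +-monoˡ-≤ (H + M) (<⇒≤ eₗ<n) ⟩
  n + (H + M)        ≤⟨ +-monoʳ-≤ n (n≤1+n (H + M)) ⟩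
  n + suc (H + M)    ≤⟨ avoids (e (suc l)) n≤eₗ₊₁ (proj₁ (proj₂ (e-pattern (suc l)))) ⟩
  e (suc l)          ∎)
  where
  H = h (fromℕ k)
  open ≤-Reasoning
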